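{- Let $F:\mathbb{F}_{2^n}\to\mathbb{F}_{2^n}$ be a function. If $S=\{(x,F(x)):x\in\mathbb{F}_{2^n}\}\subset\mathbb{F}_{2^n}^2$ is formally self dual under the trace pairing, then $F$ is bijective.
   Context: $\mathrm{Tr}:\mathbb{F}_{2^n}\to\mathbb{F}_2$ is the absolute trace. On the additive group $G=\mathbb{F}_{2^n}^2$, the trace pairing is $\langle (x,y),(a,b)\rangle=(-1)^{\mathrm{Tr}(ax+by)}$. A set $S\subset G$ is formally self dual under the trace pairing if for all $(a,b)\in G$: $\big|\sum_{(x,y)\in S}(-1)^{\mathrm{Tr}(ax+by)}\big|^2=|S|\cdot|\{(s,t)\in S^2:s-t=(a,b)\}|$ (this is the condition that $S$ and $\Delta(S)$ form a formally dual pair, where $\Delta:G\to\hat G$ is the isomorphism determined by the pairing). -}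

module Defs where

open import Data.Nat using (ℕ; zero; suc; _^_)
import Data.Nat as ℕ
open import Data.Integer using (ℤ; +_; -[1+_])
import Data.Integer as ℤ
open import Data.Fin using (Fin; _≟_)
open import Data.Bool using (Bool; true; false; if_then_else_; _∧_)
open import Data.List using (List; map; allFin; cartesianProduct; foldr)
open import Data.Product using (_×_; _,_; ∃)
open import Relation.Nullary.Decidable using (⌊_⌋)
open import Relation.Binary.PropositionalEquality using (_≡_; _≢_)
open import Algebra.Core using (Op₁; Op₂)
open import Algebra.Structures using (IsCommutativeRing)

-- A finite field with 2^n elements, realised on the carrier Fin (2 ^ n).
-- (Any such field is a model of F_{2^n}; it is unique up to isomorphism.)
record GF2^ (n : ℕ) : Set where
  field
    _⊕_ _⊗_ : Op₂ (Fin (2 ^ n))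
    ⊖_ : Op₁ (Fin (2 ^ n))
    0# 1# : Fin (2 ^ n)
    isCommutativeRing : IsCommutativeRing _≡_ _⊕_ _⊗_ ⊖_ 0# 1#
    0≢1 : 0# ≢ 1#
    inverse : ∀ x → x ≢ 0# → ∃ λ y → x ⊗ y ≡ 1#

module _ {n : ℕ} (K : GF2^ n) where
  open GF2^ K

  K' : Set
  K' = Fin (2 ^ n)

  pow : K' → ℕ → K'
  pow x zero = 1#
  pow x (suc k) = x ⊗ pow x k

  trAux : K' → ℕ → K'
  trAux x zero = 0#
  trAux x (suc i) = trAux x i ⊕ pow x (2 ^ i)

  Tr : K' → K'
  Tr x = trAux x n

  -- (-1)^Tr(z), with Tr(z) ∈ F_2 = {0#, 1#}
  χ : K' → ℤ
  χ z = if ⌊ Tr z ≟ 0# ⌋ then + 1 else -[1+ 0 ]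

  G : Set
  G = K' × K'

  elemsG : List G
  elemsG = cartesianProduct (allFin (2 ^ n)) (allFin (2 ^ n))

  sumℤ : List ℤ → ℤ
  sumℤ = foldr ℤ._+_ (+ 0)

  sumℕ : List ℕ → ℕ
  sumℕ = foldr ℕ._+_ 0

  Subset : Set
  Subset = G → Bool

  card : Subset → ℕ
  card S = sumℕ (map (λ p → if S p then 1 else 0) elemsG)

  charSum : Subset → K' → K' → ℤ
  charSum S a b = sumℤ (map (λ { (x , y) → if S (x , y) then χ ((a ⊗ x) ⊕ (b ⊗ y)) else + 0 }) elemsG)

  diffCount : Subset → K' → K' → ℕ
  diffCount S a b =
    sumℕ (map (λ { ((x , y) , (x' , y')) →
                   if S (x , y) ∧ S (x' , y') ∧ ⌊ (x ⊕ (⊖ x')) ≟ a ⌋ ∧ ⌊ (y ⊕ (⊖ y')) ≟ b ⌋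
                   then 1 else 0 })
              (cartesianProduct elemsG elemsG))

  FormallySelfDual : Subset → Set
  FormallySelfDual S = ∀ (a b : K') →
    charSum S a b ℤ.* charSum S a b ≡ + (card S ℕ.* diffCount S a b)

  graph : (K' → K') → Subset
  graph F (x , y) = ⌊ y ≟ F x ⌋

{-# OPTIONS --safe #-}
-- Summing x and x + 1 over the field shows 2^n · 1 = (1 + 1)^n = 0, so the characteristic
-- is 2; with x^(2^n) = x this makes Tr additive and Tr z² = Tr z, so Tr z ∈ {0, 1} and
-- χ = (-1)^Tr is an additive character. At (a, b) = (0, 1) no two points of a graph
-- differ by (a, b), so the self-duality condition forces Σ_x χ(F x) = 0 and χ cannot
-- be trivial; hence Σ_x χ(a x) = 0 for every a ≠ 0. If F x = F x' with x ≠ x', the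
-- condition at (x - x', 0) has left side 0 but right side at least 2^n, since the pair
-- ((x, F x), (x', F x')) is counted. So F is injective, hence bijective.
module Submission where

open import Defs
open import Data.Nat using (ℕ; _^_)
open import Data.Fin using (Fin; zero; suc)
open import Relation.Binary.PropositionalEquality using (_≡_)
open import Function.Definitions using (Bijective; Injective; Surjective)

open import Level using (0ℓ)
open import Algebra.Bundles using (CommutativeMonoid; CommutativeRing)
import Algebra.Properties.CommutativeMonoid.Sum as CommutativeMonoidSum
import Algebra.Properties.CommutativeSemigroup as CommutativeSemigroupProperties
import Algebra.Properties.Monoid.Mult as MonoidMult
import Algebra.Properties.Ring as RingProperties
import Algebra.Properties.Semiring.Mult as SemiringMult
import Algebra.Properties.Semiring.Sum as SemiringSum
import Algebra.Solver.Ring.NaturalCoefficients as NaturalCoefficientsSolver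
open import Data.Bool using (if_then_else_; _∧_)
open import Data.Empty using (⊥-elim)
import Data.Fin as Fin
import Data.Fin.Properties as Finₚ
open import Data.Fin.Permutation using (Permutation; permutation)
open import Data.Integer using (ℤ; +_; -[1+_]; -1ℤ)
import Data.Integer as ℤ
import Data.Integer.Properties as ℤₚ
open import Data.List using (List; []; _∷_; _++_; map; foldr; tabulate; allFin; cartesianProduct)
import Data.List.Properties as Listₚ
open import Data.List.Membership.Propositional using (_∈_)
open import Data.List.Membership.Propositional.Properties using (∈-cartesianProduct⁺; ∈-allFin)
open import Data.List.Relation.Unary.Any using (here; there)
open import Data.Maybe using (nothing)
import Data.Nat as ℕ
import Data.Nat.ListAction as ℕList
import Data.Nat.Properties as ℕₚ
open import Data.Product using (_×_; _,_; ∃; proj₁; proj₂)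
open import Data.Sum using (_⊎_; inj₁; inj₂; [_,_])
open import Function.Base using (id)
open import Relation.Nullary using (¬_; yes; no)
open import Relation.Nullary.Decidable using (⌊_⌋)
open import Relation.Binary.PropositionalEquality
  using (_≢_; refl; sym; trans; cong; cong₂; module ≡-Reasoning)

module ListSum {c ℓ} (M : CommutativeMonoid c ℓ) where
  open CommutativeMonoid M renaming (refl to ≈-refl; sym to ≈-sym; trans to ≈-trans)
  open CommutativeMonoidSum M public
  open import Relation.Binary.Reasoning.Setoid setoid

  listSum : List Carrier → Carrier
  listSum = foldr _∙_ ε

  listSum-++ : ∀ xs ys → listSum (xs ++ ys) ≈ listSum xs ∙ listSum ys
  listSum-++ []       ys = ≈-sym (identityˡ _)
  listSum-++ (x ∷ xs) ys = ≈-trans (∙-congˡ (listSum-++ xs ys)) (≈-sym (assoc _ _ _))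

  listSum-map-ε : ∀ {A : Set} {f : A → Carrier} xs → (∀ x → f x ≈ ε) → listSum (map f xs) ≈ ε
  listSum-map-ε []       f≈ε = ≈-refl
  listSum-map-ε (x ∷ xs) f≈ε = ≈-trans (∙-cong (f≈ε x) (listSum-map-ε xs f≈ε)) (identityʳ ε)

  listSum-tabulate : ∀ {k} (f : Fin k → Carrier) → listSum (tabulate f) ≈ sum f
  listSum-tabulate {ℕ.zero}  f = ≈-refl
  listSum-tabulate {ℕ.suc k} f = ∙-congˡ (listSum-tabulate (λ i → f (suc i)))

  listSum-map-allFin : ∀ {k} (f : Fin k → Carrier) → listSum (map f (allFin k)) ≈ sum f
  listSum-map-allFin {k} f = ≈-trans (reflexive (cong listSum (Listₚ.map-tabulate id f))) (listSum-tabulate f)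

  listSum-map-cartesianProduct : ∀ {A B : Set} (g : A × B → Carrier) xs (ys : List B) →
    listSum (map g (cartesianProduct xs ys)) ≈ listSum (map (λ x → listSum (map (λ y → g (x , y)) ys)) xs)
  listSum-map-cartesianProduct g []       ys = ≈-refl
  listSum-map-cartesianProduct g (x ∷ xs) ys = begin
    listSum (map g (map (x ,_) ys ++ cartesianProduct xs ys))
      ≡⟨ cong listSum (Listₚ.map-++ g (map (x ,_) ys) _) ⟩
    listSum (map g (map (x ,_) ys) ++ map g (cartesianProduct xs ys))
      ≈⟨ listSum-++ (map g (map (x ,_) ys)) _ ⟩
    listSum (map g (map (x ,_) ys)) ∙ listSum (map g (cartesianProduct xs ys))
      ≈⟨ ∙-cong (reflexive (cong listSum (sym (Listₚ.map-∘ ys)))) (listSum-map-cartesianProduct g xs ys) ⟩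
    listSum (map (λ y → g (x , y)) ys) ∙ listSum (map (λ x → listSum (map (λ y → g (x , y)) ys)) xs) ∎

  sum-indicator : ∀ {k} (d : Fin k) (h : Fin k → Carrier) →
    sum (λ y → if ⌊ y Fin.≟ d ⌋ then h y else ε) ≈ h d
  sum-indicator {ℕ.suc k} zero    h = ≈-trans (∙-congˡ (sum-replicate-zero k)) (identityʳ _)
  sum-indicator {ℕ.suc k} (suc d) h =
    ≈-trans (identityˡ _) (≈-trans (reflexive (sum-cong-≗ shift)) (sum-indicator d (λ y → h (suc y))))
    where
    shift : ∀ y → (if ⌊ suc y Fin.≟ suc d ⌋ then h (suc y) else ε) ≡ (if ⌊ y Fin.≟ d ⌋ then h (suc y) else ε)
    shift y with y Fin.≟ d
    ... | yes _ = refl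
    ... | no _  = refl

  listSum-graph : ∀ {k} (g : Fin k → Fin k) (h : Fin k × Fin k → Carrier) →
    listSum (map (λ p → if ⌊ proj₂ p Fin.≟ g (proj₁ p) ⌋ then h p else ε) (cartesianProduct (allFin k) (allFin k)))
      ≈ sum (λ x → h (x , g x))
  listSum-graph {k} g h = begin
    listSum (map f (cartesianProduct (allFin k) (allFin k)))
      ≈⟨ listSum-map-cartesianProduct f (allFin k) (allFin k) ⟩
    listSum (map (λ x → listSum (map (λ y → f (x , y)) (allFin k))) (allFin k))
      ≈⟨ listSum-map-allFin (λ x → listSum (map (λ y → f (x , y)) (allFin k))) ⟩
    sum (λ x → listSum (map (λ y → f (x , y)) (allFin k)))
      ≈⟨ sum-cong-≋ (λ x → ≈-trans (listSum-map-allFin (λ y → f (x , y))) (sum-indicator (g x) (λ y → h (x , y)))) ⟩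
    sum (λ x → h (x , g x)) ∎
    where
    f : Fin k × Fin k → Carrier
    f p = if ⌊ proj₂ p Fin.≟ g (proj₁ p) ⌋ then h p else ε

module NatSum = ListSum ℕₚ.+-0-commutativeMonoid
module IntegerSum = ListSum ℤₚ.+-0-commutativeMonoid

∑-1 : ∀ k → NatSum.sum {k} (λ _ → 1) ≡ k
∑-1 ℕ.zero    = refl
∑-1 (ℕ.suc k) = cong ℕ.suc (∑-1 k)

∑-+1 : ∀ k → IntegerSum.sum {k} (λ _ → + 1) ≡ + k
∑-+1 ℕ.zero    = refl
∑-+1 (ℕ.suc k) = cong (ℤ._+_ (+ 1)) (∑-+1 k)

∈⇒≤sum-map : ∀ {A : Set} (f : A → ℕ) {x xs} → x ∈ xs → f x ℕ.≤ ℕList.sum (map f xs)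
∈⇒≤sum-map f (here refl) = ℕₚ.m≤m+n _ _
∈⇒≤sum-map f {xs = y ∷ ys} (there x∈ys) = ℕₚ.≤-trans (∈⇒≤sum-map f x∈ys) (ℕₚ.m≤n+m _ (f y))

-- If y is not hit, punchOut turns f into an injection Fin (suc k) → Fin k.
injective⇒surjective : ∀ {k} {f : Fin k → Fin k} → Injective _≡_ _≡_ f → Surjective _≡_ _≡_ f
injective⇒surjective {ℕ.suc k} {f} f-inj y with Finₚ.any? (λ x → f x Fin.≟ y)
... | yes (x , fx≡y) = x , λ { refl → fx≡y }
... | no ∄x = ⊥-elim (ℕₚ.<-irrefl refl (Finₚ.injective⇒≤ squeeze-injective))
  where
  missed : ∀ x → y ≢ f x
  missed x y≡fx = ∄x (x , sym y≡fx)
  squeeze-injective : Injective _≡_ _≡_ (λ x → Fin.punchOut (missed x))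
  squeeze-injective {a} {b} eq = f-inj (Finₚ.punchOut-injective (missed a) (missed b) eq)

module _ {n : ℕ} (K : GF2^ n) where
  open GF2^ K
  open ≡-Reasoning

  q : ℕ
  q = 2 ^ n

  K-commutativeRing : CommutativeRing 0ℓ 0ℓ
  K-commutativeRing = record { isCommutativeRing = isCommutativeRing }

  private
    module R where
      open CommutativeRing K-commutativeRing public
      open RingProperties (CommutativeRing.ring K-commutativeRing) public
      open SemiringMult semiring public using (_×_; ×1-homo-*)
    module Additive = ListSum R.+-commutativeMonoid
    module Multiplicative = ListSum R.*-commutativeMonoid
    module Power = MonoidMult R.*-monoid

  ⊗-cancelʳ : ∀ {x y z} → z ≢ 0# → x ⊗ z ≡ y ⊗ z → x ≡ y
  ⊗-cancelʳ {x} {y} {z} z≢0 xz≡yz with inverse z z≢0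
  ... | w , zw≡1 = begin
    x             ≡⟨ R.*-identityʳ x ⟨
    x ⊗ 1#        ≡⟨ cong (x ⊗_) zw≡1 ⟨
    x ⊗ (z ⊗ w)   ≡⟨ R.*-assoc x z w ⟨
    (x ⊗ z) ⊗ w   ≡⟨ cong (_⊗ w) xz≡yz ⟩
    (y ⊗ z) ⊗ w   ≡⟨ R.*-assoc y z w ⟩
    y ⊗ (z ⊗ w)   ≡⟨ cong (y ⊗_) zw≡1 ⟩
    y ⊗ 1#        ≡⟨ R.*-identityʳ y ⟩
    y             ∎

  ⊗-noZeroDivisors : ∀ x y → x ⊗ y ≡ 0# → x ≡ 0# ⊎ y ≡ 0#
  ⊗-noZeroDivisors x y xy≡0 with y Fin.≟ 0#
  ... | yes y≡0 = inj₂ y≡0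
  ... | no y≢0  = inj₁ (⊗-cancelʳ y≢0 (trans xy≡0 (sym (R.zeroˡ y))))

  pow≡0⇒≡0 : ∀ x k → pow K x k ≡ 0# → x ≡ 0#
  pow≡0⇒≡0 x ℕ.zero    1≡0 = ⊥-elim (0≢1 (sym 1≡0))
  pow≡0⇒≡0 x (ℕ.suc k) eq with ⊗-noZeroDivisors x (pow K x k) eq
  ... | inj₁ x≡0 = x≡0
  ... | inj₂ xᵏ≡0 = pow≡0⇒≡0 x k xᵏ≡0

  pow≡× : ∀ x k → pow K x k ≡ k Power.× x
  pow≡× x ℕ.zero    = refl
  pow≡× x (ℕ.suc k) = cong (x ⊗_) (pow≡× x k)

  pow-+ : ∀ x i j → pow K x (i ℕ.+ j) ≡ pow K x i ⊗ pow K x j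
  pow-+ x i j = begin
    pow K x (i ℕ.+ j)              ≡⟨ pow≡× x (i ℕ.+ j) ⟩
    (i ℕ.+ j) Power.× x            ≡⟨ Power.×-homo-+ x i j ⟩
    (i Power.× x) ⊗ (j Power.× x)  ≡⟨ cong₂ _⊗_ (pow≡× x i) (pow≡× x j) ⟨
    pow K x i ⊗ pow K x j          ∎

  translation : Fin q → Permutation q q
  translation c = permutation (_⊕ c) (_⊕ (⊖ c)) (R.//-rightDividesˡ c) (R.//-rightDividesʳ c)

  2^k×1≡pow : ∀ k → (2 ^ k) R.× 1# ≡ pow K (2 R.× 1#) k
  2^k×1≡pow ℕ.zero    = R.+-identityʳ 1#
  2^k×1≡pow (ℕ.suc k) = trans (R.×1-homo-* 2 (2 ^ k)) (cong ((2 R.× 1#) ⊗_) (2^k×1≡pow k))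

  q×1≡0 : q R.× 1# ≡ 0#
  q×1≡0 = R.+-identityʳ-unique Σx (q R.× 1#) (sym (begin
    Σx                                            ≡⟨ Additive.∑-permute id (translation 1#) ⟩
    Additive.sum (λ x → x ⊕ 1#)                   ≡⟨ Additive.∑-distrib-+ id (λ _ → 1#) ⟩
    Σx ⊕ Additive.sum {q} (λ _ → 1#)              ≡⟨ cong (Σx ⊕_) (Additive.sum-replicate q) ⟩
    Σx ⊕ (q R.× 1#)                               ∎))
    where
    Σx : Fin q
    Σx = Additive.sum {q} id

  1⊕1≡0 : 1# ⊕ 1# ≡ 0#
  1⊕1≡0 = trans (cong (1# ⊕_) (sym (R.+-identityʳ 1#)))
                (pow≡0⇒≡0 (2 R.× 1#) n (trans (sym (2^k×1≡pow n)) q×1≡0))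

  x⊕x≡0 : ∀ x → x ⊕ x ≡ 0#
  x⊕x≡0 x = begin
    x ⊕ x                ≡⟨ cong₂ _⊕_ (R.*-identityˡ x) (R.*-identityˡ x) ⟨
    (1# ⊗ x) ⊕ (1# ⊗ x)  ≡⟨ R.distribʳ x 1# 1# ⟨
    (1# ⊕ 1#) ⊗ x        ≡⟨ cong (_⊗ x) 1⊕1≡0 ⟩
    0# ⊗ x               ≡⟨ R.zeroˡ x ⟩
    0#                   ∎

  scaling : ∀ {a b} → a ⊗ b ≡ 1# → Permutation q q
  scaling {a} {b} ab≡1 = permutation (a ⊗_) (b ⊗_)
    (λ y → trans (sym (R.*-assoc a b y)) (trans (cong (_⊗ y) ab≡1) (R.*-identityˡ y)))
    (λ x → trans (sym (R.*-assoc b a x)) (trans (cong (_⊗ x) (trans (R.*-comm b a) ab≡1)) (R.*-identityˡ x)))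

  nonzeroOr1 : Fin q → Fin q
  nonzeroOr1 x = if ⌊ x Fin.≟ 0# ⌋ then 1# else x

  nonzeroOr1≢0 : ∀ x → nonzeroOr1 x ≢ 0#
  nonzeroOr1≢0 x with x Fin.≟ 0#
  ... | yes _   = λ 1≡0 → 0≢1 (sym 1≡0)
  ... | no x≢0  = x≢0

  ∏≢0 : ∀ {k} (f : Fin k → Fin q) → (∀ i → f i ≢ 0#) → Multiplicative.sum f ≢ 0#
  ∏≢0 {ℕ.zero}  f f≢0 1≡0 = 0≢1 (sym 1≡0)
  ∏≢0 {ℕ.suc k} f f≢0 ∏≡0 with ⊗-noZeroDivisors (f zero) _ ∏≡0
  ... | inj₁ f₀≡0 = f≢0 zero f₀≡0
  ... | inj₂ rest≡0 = ∏≢0 (λ i → f (suc i)) (λ i → f≢0 (suc i)) rest≡0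

  -- x ↦ a x permutes the field, so ∏ nonzeroOr1 (a x) = P, the product of the units.
  -- Termwise nonzeroOr1 (a x) = a · nonzeroOr1 x except at x = 0, where e supplies the
  -- missing factor a; hence a P = a^q P.
  pow-q : ∀ a → pow K a q ≡ a
  pow-q a with a Fin.≟ 0#
  ... | yes refl = pow-0 q (ℕₚ.m^n>0 2 n)
    where
    pow-0 : ∀ k → 0 ℕ.< k → pow K 0# k ≡ 0#
    pow-0 (ℕ.suc k) _ = R.zeroˡ _
  ... | no a≢0 with inverse a a≢0
  ...   | b , ab≡1 = sym (⊗-cancelʳ (∏≢0 nonzeroOr1 nonzeroOr1≢0) (begin
    a ⊗ P                                        ≡⟨ cong₂ _⊗_ (sym (Multiplicative.sum-indicator 0# (λ _ → a)))
                                                              (Multiplicative.∑-permute nonzeroOr1 (scaling ab≡1)) ⟩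
    Multiplicative.sum e ⊗ Multiplicative.sum (λ x → nonzeroOr1 (a ⊗ x))
                                                 ≡⟨ Multiplicative.∑-distrib-+ e (λ x → nonzeroOr1 (a ⊗ x)) ⟨
    Multiplicative.sum (λ x → e x ⊗ nonzeroOr1 (a ⊗ x)) ≡⟨ Multiplicative.sum-cong-≗ scale ⟩
    Multiplicative.sum (λ x → a ⊗ nonzeroOr1 x)  ≡⟨ Multiplicative.∑-distrib-+ (λ _ → a) nonzeroOr1 ⟩
    Multiplicative.sum {q} (λ _ → a) ⊗ P         ≡⟨ cong (_⊗ P) (Multiplicative.sum-replicate q) ⟩
    (q Power.× a) ⊗ P                            ≡⟨ cong (_⊗ P) (pow≡× a q) ⟨
    pow K a q ⊗ P                                ∎))
    where
    P : Fin q
    P = Multiplicative.sum nonzeroOr1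
    e : Fin q → Fin q
    e x = if ⌊ x Fin.≟ 0# ⌋ then a else 1#
    scale : ∀ x → e x ⊗ nonzeroOr1 (a ⊗ x) ≡ a ⊗ nonzeroOr1 x
    scale x with x Fin.≟ 0# | (a ⊗ x) Fin.≟ 0#
    ... | yes _    | yes _    = refl
    ... | yes x≡0  | no ax≢0  = ⊥-elim (ax≢0 (trans (cong (a ⊗_) x≡0) (R.zeroʳ a)))
    ... | no x≢0   | yes ax≡0 = ⊥-elim ([ a≢0 , x≢0 ] (⊗-noZeroDivisors a x ax≡0))
    ... | no _     | no _     = R.*-identityˡ _

  pow-2^-suc : ∀ x i → pow K x (2 ^ ℕ.suc i) ≡ pow K x (2 ^ i) ⊗ pow K x (2 ^ i)
  pow-2^-suc x i = trans (pow-+ x (2 ^ i) (2 ^ i ℕ.+ 0)) (cong (pow K x (2 ^ i) ⊗_) (cong (pow K x) (ℕₚ.+-identityʳ (2 ^ i))))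

  square-⊕ : ∀ u v → (u ⊕ v) ⊗ (u ⊕ v) ≡ (u ⊗ u) ⊕ (v ⊗ v)
  square-⊕ u v = begin
    (u ⊕ v) ⊗ (u ⊕ v)                          ≡⟨ expand u v ⟩
    ((u ⊗ u) ⊕ (v ⊗ v)) ⊕ ((u ⊗ v) ⊕ (u ⊗ v))  ≡⟨ cong (((u ⊗ u) ⊕ (v ⊗ v)) ⊕_) (x⊕x≡0 (u ⊗ v)) ⟩
    ((u ⊗ u) ⊕ (v ⊗ v)) ⊕ 0#                   ≡⟨ R.+-identityʳ _ ⟩
    (u ⊗ u) ⊕ (v ⊗ v)                          ∎
    where
    open NaturalCoefficientsSolver R.commutativeSemiring (λ _ _ → nothing)
    expand : ∀ u v → (u ⊕ v) ⊗ (u ⊕ v) ≡ ((u ⊗ u) ⊕ (v ⊗ v)) ⊕ ((u ⊗ v) ⊕ (u ⊗ v))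
    expand = solve 2 (λ u v → (u :+ v) :* (u :+ v) := ((u :* u) :+ (v :* v)) :+ ((u :* v) :+ (u :* v))) refl

  frobenius : ∀ i u v → pow K (u ⊕ v) (2 ^ i) ≡ pow K u (2 ^ i) ⊕ pow K v (2 ^ i)
  frobenius ℕ.zero    u v = R.distribʳ 1# u v
  frobenius (ℕ.suc i) u v = begin
    pow K (u ⊕ v) (2 ^ ℕ.suc i)                    ≡⟨ pow-2^-suc (u ⊕ v) i ⟩
    pow K (u ⊕ v) (2 ^ i) ⊗ pow K (u ⊕ v) (2 ^ i)  ≡⟨ cong (λ z → z ⊗ z) (frobenius i u v) ⟩
    (uⁱ ⊕ vⁱ) ⊗ (uⁱ ⊕ vⁱ)                          ≡⟨ square-⊕ uⁱ vⁱ ⟩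
    (uⁱ ⊗ uⁱ) ⊕ (vⁱ ⊗ vⁱ)                          ≡⟨ cong₂ _⊕_ (pow-2^-suc u i) (pow-2^-suc v i) ⟨
    pow K u (2 ^ ℕ.suc i) ⊕ pow K v (2 ^ ℕ.suc i)  ∎
    where
    uⁱ = pow K u (2 ^ i)
    vⁱ = pow K v (2 ^ i)

  trAux-⊕ : ∀ i u v → trAux K (u ⊕ v) i ≡ trAux K u i ⊕ trAux K v i
  trAux-⊕ ℕ.zero    u v = sym (R.+-identityʳ 0#)
  trAux-⊕ (ℕ.suc i) u v = trans (cong₂ _⊕_ (trAux-⊕ i u v) (frobenius i u v))
    (CommutativeSemigroupProperties.interchange R.+-commutativeSemigroup _ _ _ _)

  Tr-⊕ : ∀ u v → Tr K (u ⊕ v) ≡ Tr K u ⊕ Tr K v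
  Tr-⊕ = trAux-⊕ n

  trAux-square : ∀ x i → trAux K x i ⊗ trAux K x i ≡ (trAux K x i ⊕ x) ⊕ pow K x (2 ^ i)
  trAux-square x ℕ.zero = begin
    0# ⊗ 0#               ≡⟨ R.zeroˡ 0# ⟩
    0#                    ≡⟨ x⊕x≡0 x ⟨
    x ⊕ x                 ≡⟨ cong₂ _⊕_ (R.+-identityˡ x) (R.*-identityʳ x) ⟨
    (0# ⊕ x) ⊕ (x ⊗ 1#)   ∎
  trAux-square x (ℕ.suc i) = begin
    (T ⊕ xⁱ) ⊗ (T ⊕ xⁱ)          ≡⟨ square-⊕ T xⁱ ⟩
    (T ⊗ T) ⊕ (xⁱ ⊗ xⁱ)          ≡⟨ cong₂ _⊕_ (trAux-square x i) (sym (pow-2^-suc x i)) ⟩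
    ((T ⊕ x) ⊕ xⁱ) ⊕ xⁱ⁺¹        ≡⟨ cong (_⊕ xⁱ⁺¹) (CommutativeSemigroupProperties.xy∙z≈xz∙y R.+-commutativeSemigroup T x xⁱ) ⟩
    ((T ⊕ xⁱ) ⊕ x) ⊕ xⁱ⁺¹        ∎
    where
    T = trAux K x i
    xⁱ = pow K x (2 ^ i)
    xⁱ⁺¹ = pow K x (2 ^ ℕ.suc i)

  Tr-idempotent : ∀ z → Tr K z ⊗ Tr K z ≡ Tr K z
  Tr-idempotent z = begin
    Tr K z ⊗ Tr K z                ≡⟨ trAux-square z n ⟩
    (Tr K z ⊕ z) ⊕ pow K z q       ≡⟨ cong ((Tr K z ⊕ z) ⊕_) (pow-q z) ⟩
    (Tr K z ⊕ z) ⊕ z               ≡⟨ R.+-assoc _ _ _ ⟩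
    Tr K z ⊕ (z ⊕ z)               ≡⟨ cong (Tr K z ⊕_) (x⊕x≡0 z) ⟩
    Tr K z ⊕ 0#                    ≡⟨ R.+-identityʳ _ ⟩
    Tr K z                         ∎

  IsBit : Fin q → Set
  IsBit t = t ≡ 0# ⊎ t ≡ 1#

  idempotent⇒IsBit : ∀ t → t ⊗ t ≡ t → IsBit t
  idempotent⇒IsBit t tt≡t with ⊗-noZeroDivisors t (t ⊕ 1#) t[t+1]≡0
    where
    t[t+1]≡0 : t ⊗ (t ⊕ 1#) ≡ 0#
    t[t+1]≡0 = trans (R.distribˡ t t 1#) (trans (cong₂ _⊕_ tt≡t (R.*-identityʳ t)) (x⊕x≡0 t))
  ... | inj₁ t≡0   = inj₁ t≡0
  ... | inj₂ t+1≡0 = inj₂ (begin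
    t                 ≡⟨ R.+-identityʳ t ⟨
    t ⊕ 0#            ≡⟨ cong (t ⊕_) 1⊕1≡0 ⟨
    t ⊕ (1# ⊕ 1#)     ≡⟨ R.+-assoc t 1# 1# ⟨
    (t ⊕ 1#) ⊕ 1#     ≡⟨ cong (_⊕ 1#) t+1≡0 ⟩
    0# ⊕ 1#           ≡⟨ R.+-identityˡ 1# ⟩
    1#                ∎)

  Tr-IsBit : ∀ z → IsBit (Tr K z)
  Tr-IsBit z = idempotent⇒IsBit (Tr K z) (Tr-idempotent z)

  -- χ K z unfolds to sign (Tr K z).
  sign : Fin q → ℤ
  sign t = if ⌊ t Fin.≟ 0# ⌋ then + 1 else -1ℤ

  sign-0# : sign 0# ≡ + 1
  sign-0# with 0# Fin.≟ 0#
  ... | yes _   = refl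
  ... | no 0≢0  = ⊥-elim (0≢0 refl)

  sign-≢0 : ∀ {t} → t ≢ 0# → sign t ≡ -1ℤ
  sign-≢0 {t} t≢0 with t Fin.≟ 0#
  ... | yes t≡0 = ⊥-elim (t≢0 t≡0)
  ... | no _    = refl

  sign-1# : sign 1# ≡ -1ℤ
  sign-1# = sign-≢0 (λ 1≡0 → 0≢1 (sym 1≡0))

  sign-⊕ : ∀ {t s} → IsBit t → IsBit s → sign (t ⊕ s) ≡ sign t ℤ.* sign s
  sign-⊕ (inj₁ refl) (inj₁ refl) rewrite sign-0# = trans (cong sign (R.+-identityʳ 0#)) sign-0#
  sign-⊕ (inj₁ refl) (inj₂ refl) rewrite sign-0# | sign-1# = trans (cong sign (R.+-identityˡ 1#)) sign-1#
  sign-⊕ (inj₂ refl) (inj₁ refl) rewrite sign-0# | sign-1# = trans (cong sign (R.+-identityʳ 1#)) sign-1#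
  sign-⊕ (inj₂ refl) (inj₂ refl) rewrite sign-1# = trans (cong sign 1⊕1≡0) sign-0#

  χ-⊕ : ∀ u v → χ K (u ⊕ v) ≡ χ K u ℤ.* χ K v
  χ-⊕ u v = trans (cong sign (Tr-⊕ u v)) (sign-⊕ (Tr-IsBit u) (Tr-IsBit v))

  -- Translating x by c = a⁻¹ z₀ multiplies every term by χ z₀ = -1.
  χ-orthogonal : ∀ {z₀} → Tr K z₀ ≢ 0# → ∀ {a} → a ≢ 0# → IntegerSum.sum (λ x → χ K (a ⊗ x)) ≡ + 0
  χ-orthogonal {z₀} Trz₀≢0 {a} a≢0 with inverse a a≢0
  ... | b , ab≡1 = self-negation (begin
    S                                          ≡⟨ IntegerSum.∑-permute (λ x → χ K (a ⊗ x)) (translation c) ⟩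
    IntegerSum.sum (λ x → χ K (a ⊗ (x ⊕ c)))   ≡⟨ IntegerSum.sum-cong-≗ shift ⟩
    IntegerSum.sum (λ x → χ K (a ⊗ x) ℤ.* -1ℤ)  ≡⟨ SemiringSum.*-distribʳ-sum ℤₚ.+-*-semiring -1ℤ (λ x → χ K (a ⊗ x)) ⟨
    S ℤ.* -1ℤ                                   ∎)
    where
    S = IntegerSum.sum (λ x → χ K (a ⊗ x))
    c = b ⊗ z₀
    shift : ∀ x → χ K (a ⊗ (x ⊕ c)) ≡ χ K (a ⊗ x) ℤ.* -1ℤ
    shift x = begin
      χ K (a ⊗ (x ⊕ c))          ≡⟨ cong (χ K) (R.distribˡ a x c) ⟩
      χ K ((a ⊗ x) ⊕ (a ⊗ c))    ≡⟨ cong (λ w → χ K ((a ⊗ x) ⊕ w)) (trans (sym (R.*-assoc a b z₀))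
                                      (trans (cong (_⊗ z₀) ab≡1) (R.*-identityˡ z₀))) ⟩
      χ K ((a ⊗ x) ⊕ z₀)         ≡⟨ χ-⊕ (a ⊗ x) z₀ ⟩
      χ K (a ⊗ x) ℤ.* χ K z₀     ≡⟨ cong (χ K (a ⊗ x) ℤ.*_) (sign-≢0 Trz₀≢0) ⟩
      χ K (a ⊗ x) ℤ.* -1ℤ         ∎
    self-negation : ∀ {i} → i ≡ i ℤ.* -1ℤ → i ≡ + 0
    self-negation {+ ℕ.zero}  _  = refl
    self-negation {+ ℕ.suc _} ()
    self-negation { -[1+ _ ]} ()

  q≢0 : q ≢ 0
  q≢0 = ℕ.≢-nonZero⁻¹ q {{ℕₚ.m^n≢0 2 n}}

  module _ (F : Fin q → Fin q) where

    Γ : Subset K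
    Γ = graph K F

    charSum-graph : ∀ a b → charSum K (Γ) a b ≡ IntegerSum.sum (λ x → χ K ((a ⊗ x) ⊕ (b ⊗ F x)))
    charSum-graph a b = IntegerSum.listSum-graph F (λ { (x , y) → χ K ((a ⊗ x) ⊕ (b ⊗ y)) })

    card-graph : card K (Γ) ≡ q
    card-graph = trans (NatSum.listSum-graph F (λ _ → 1)) (∑-1 q)

    graph-no-vertical-unit : ∀ {x y x' y'} → y ≡ F x → y' ≡ F x' → x ⊕ (⊖ x') ≡ 0# → y ⊕ (⊖ y') ≢ 1#
    graph-no-vertical-unit {x} {y} {x'} {y'} y≡Fx y'≡Fx' x-x'≡0 y-y'≡1 = 0≢1 (begin
      0#          ≡⟨ R.x≈y⇒x∙y⁻¹≈ε y≡y' ⟨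
      y ⊕ (⊖ y')  ≡⟨ y-y'≡1 ⟩
      1#          ∎)
      where
      y≡y' : y ≡ y'
      y≡y' = trans y≡Fx (trans (cong F (R.x∙y⁻¹≈ε⇒x≈y x x' x-x'≡0)) (sym y'≡Fx'))

    diffCount-graph-vertical : diffCount K (Γ) 0# 1# ≡ 0
    diffCount-graph-vertical = NatSum.listSum-map-ε (cartesianProduct (elemsG K) (elemsG K))
      (λ { ((x , y) , (x' , y')) → uncounted x y x' y' })
      where
      uncounted : ∀ x y x' y' →
        (if ⌊ y Fin.≟ F x ⌋ ∧ ⌊ y' Fin.≟ F x' ⌋ ∧ ⌊ (x ⊕ (⊖ x')) Fin.≟ 0# ⌋ ∧ ⌊ (y ⊕ (⊖ y')) Fin.≟ 1# ⌋
         then 1 else 0) ≡ 0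
      uncounted x y x' y' with y Fin.≟ F x | y' Fin.≟ F x' | (x ⊕ (⊖ x')) Fin.≟ 0# | (y ⊕ (⊖ y')) Fin.≟ 1#
      ... | yes y≡Fx | yes y'≡Fx' | yes x-x'≡0 | yes y-y'≡1 = ⊥-elim (graph-no-vertical-unit y≡Fx y'≡Fx' x-x'≡0 y-y'≡1)
      ... | no _  | _     | _     | _     = refl
      ... | yes _ | no _  | _     | _     = refl
      ... | yes _ | yes _ | no _  | _     = refl
      ... | yes _ | yes _ | yes _ | no _  = refl

    diffCount-graph-collision : ∀ {x x'} → F x ≡ F x' → 1 ℕ.≤ diffCount K (Γ) (x ⊕ (⊖ x')) 0#
    diffCount-graph-collision {x} {x'} Fx≡Fx' = ℕₚ.≤-trans (ℕₚ.≤-reflexive (sym counted)) (∈⇒≤sum-map _ pair∈)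
      where
      pair∈ : ((x , F x) , (x' , F x')) ∈ cartesianProduct (elemsG K) (elemsG K)
      pair∈ = ∈-cartesianProduct⁺ (∈-cartesianProduct⁺ (∈-allFin x) (∈-allFin (F x)))
                                  (∈-cartesianProduct⁺ (∈-allFin x') (∈-allFin (F x')))
      counted : (if ⌊ F x Fin.≟ F x ⌋ ∧ ⌊ F x' Fin.≟ F x' ⌋ ∧ ⌊ (x ⊕ (⊖ x')) Fin.≟ (x ⊕ (⊖ x')) ⌋
                    ∧ ⌊ (F x ⊕ (⊖ F x')) Fin.≟ 0# ⌋ then 1 else 0) ≡ 1
      counted with F x Fin.≟ F x | F x' Fin.≟ F x' | (x ⊕ (⊖ x')) Fin.≟ (x ⊕ (⊖ x')) | (F x ⊕ (⊖ F x')) Fin.≟ 0#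
      ... | yes _ | yes _ | yes _ | yes _   = refl
      ... | no ≢  | _     | _     | _       = ⊥-elim (≢ refl)
      ... | yes _ | no ≢  | _     | _       = ⊥-elim (≢ refl)
      ... | yes _ | yes _ | no ≢  | _       = ⊥-elim (≢ refl)
      ... | yes _ | yes _ | yes _ | no ≢0   = ⊥-elim (≢0 (R.x≈y⇒x∙y⁻¹≈ε Fx≡Fx'))

    module _ (selfDual : FormallySelfDual K (Γ)) where

      charSum²-graph : ∀ a b → charSum K (Γ) a b ℤ.* charSum K (Γ) a b ≡ + (q ℕ.* diffCount K (Γ) a b)
      charSum²-graph a b = trans (selfDual a b) (cong (λ c → + (c ℕ.* diffCount K (Γ) a b)) card-graph)

      diffCount≡0⇒charSum≡0 : ∀ {a b} → diffCount K (Γ) a b ≡ 0 → charSum K (Γ) a b ≡ + 0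
      diffCount≡0⇒charSum≡0 {a} {b} d≡0 with ℤₚ.i*j≡0⇒i≡0∨j≡0 _ (trans (charSum²-graph a b) (cong +_ (trans (cong (q ℕ.*_) d≡0) (ℕₚ.*-zeroʳ q))))
      ... | inj₁ c≡0 = c≡0
      ... | inj₂ c≡0 = c≡0

      charSum≡0⇒diffCount≡0 : ∀ {a b} → charSum K (Γ) a b ≡ + 0 → diffCount K (Γ) a b ≡ 0
      charSum≡0⇒diffCount≡0 {a} {b} c≡0 with ℕₚ.m*n≡0⇒m≡0∨n≡0 q (ℤₚ.+-injective (trans (sym (charSum²-graph a b)) (cong (λ c → c ℤ.* c) c≡0)))
      ... | inj₁ q≡0 = ⊥-elim (q≢0 q≡0)
      ... | inj₂ d≡0 = d≡0

      Tr-nontrivial : ∃ λ z → Tr K z ≢ 0#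
      Tr-nontrivial = Finₚ.¬∀⟶∃¬ q _ (λ z → Tr K z Fin.≟ 0#) ¬Tr≡0
        where
        ¬Tr≡0 : ¬ (∀ z → Tr K z ≡ 0#)
        ¬Tr≡0 Tr≡0 = q≢0 (ℤₚ.+-injective (begin
          + q                                                    ≡⟨ ∑-+1 q ⟨
          IntegerSum.sum {q} (λ _ → + 1)                         ≡⟨ IntegerSum.sum-cong-≗ χ≡1 ⟨
          IntegerSum.sum (λ x → χ K ((0# ⊗ x) ⊕ (1# ⊗ F x)))     ≡⟨ charSum-graph 0# 1# ⟨
          charSum K (Γ) 0# 1#                            ≡⟨ diffCount≡0⇒charSum≡0 diffCount-graph-vertical ⟩
          + 0                                                    ∎))
          where
          χ≡1 : ∀ x → χ K ((0# ⊗ x) ⊕ (1# ⊗ F x)) ≡ + 1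
          χ≡1 x = trans (cong sign (Tr≡0 _)) sign-0#

      graph-injective : Injective _≡_ _≡_ F
      graph-injective {x} {x'} Fx≡Fx' with x Fin.≟ x'
      ... | yes x≡x' = x≡x'
      ... | no x≢x'  = ⊥-elim (ℕₚ.<⇒≢ (diffCount-graph-collision Fx≡Fx') (sym (charSum≡0⇒diffCount≡0 (begin
        charSum K (Γ) a 0#                      ≡⟨ charSum-graph a 0# ⟩
        IntegerSum.sum (λ y → χ K ((a ⊗ y) ⊕ (0# ⊗ F y))) ≡⟨ IntegerSum.sum-cong-≗ drop-F ⟩
        IntegerSum.sum (λ y → χ K (a ⊗ y))              ≡⟨ χ-orthogonal (proj₂ Tr-nontrivial) a≢0 ⟩
        + 0                                             ∎))))
        where
        a = x ⊕ (⊖ x')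
        a≢0 : a ≢ 0#
        a≢0 a≡0 = x≢x' (R.x∙y⁻¹≈ε⇒x≈y x x' a≡0)
        drop-F : ∀ y → χ K ((a ⊗ y) ⊕ (0# ⊗ F y)) ≡ χ K (a ⊗ y)
        drop-F y = cong (χ K) (trans (cong ((a ⊗ y) ⊕_) (R.zeroˡ (F y))) (R.+-identityʳ _))

corollary6p5 : (n : ℕ) (K : GF2^ n) (F : Fin (2 ^ n) → Fin (2 ^ n)) →
    FormallySelfDual K (graph K F) → Bijective _≡_ _≡_ F
corollary6p5 n K F selfDual = F-injective , injective⇒surjective F-injective
  where
  F-injective : Injective _≡_ _≡_ F
  F-injective = graph-injective K F selfDual
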